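{- The set of (Gödel indices of) unobservable $\mathbb{VPC}$-processes is undecidable, where a process $P$ is unobservable if there is no $P'$ with $P\Longrightarrow P'\xrightarrow{\alpha}$ for some action $\alpha\neq\tau$.
   Context: $\mathbb{VPC}$ is the value-passing calculus over Presburger arithmetic: terms $T ::= \mathbf{0}\mid a(x).T\mid \overline{a}(t).T\mid T|T\mid (c)T\mid \mathit{if}\ \varphi\ \mathit{then}\ T\mid D(t_1,\dots,t_k)$, with value terms $t$ built from numbers, number variables and $+$, Presburger formulas $\varphi$, names $a,c$, and parametric (possibly recursive) definitions $D(x_1,\dots,x_k)=T$; processes are terms without free variables. Transitions: $a(x).T\xrightarrow{a(i)}T\{i/x\}$; $\overline{a}(t).T\xrightarrow{\overline{a}(i)}T$ if $\vdash t=i$ in Presburger arithmetic; parallel components act independently and a matching input $a(i)$ and output $\overline{a}(i)$ synchronise to $\tau$; $(c)T$ performs the actions of $T$ not on $c$; $\mathit{if}\ \varphi\ \mathit{then}\ T$ behaves as $T$ when $\vdash\varphi$; $D(\vec t)$ behaves as its body with $\vec t$ substituted for the parameters. $\Longrightarrow$ is the reflexive–transitive closure of $\xrightarrow{\tau}$. Processes are Gödel-numbered by an effective bijective numbering of terms together with the parametric definitions they use. -}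

module Defs where

open import Data.Nat using (ℕ; zero; suc; _+_; _*_; _∸_; _^_; _<_; _≡ᵇ_)
open import Data.Bool using (if_then_else_)
open import Data.Fin using (Fin)
open import Data.Vec using (Vec; []; _∷_; lookup)
open import Data.List using (List; []; _∷_; length; zip)
open import Data.List.Membership.Propositional using (_∈_)
open import Data.List.Relation.Unary.All using (All)
open import Data.Maybe using (Maybe; just; nothing)
open import Data.Product using (Σ; ∃; _×_; _,_)
open import Data.Unit using (⊤)
open import Data.Sum using (_⊎_)
open import Relation.Nullary using (¬_)
open import Relation.Binary.PropositionalEquality using (_≡_; _≢_)
open import Relation.Binary.Construct.Closure.ReflexiveTransitive using (Star)

Name : Set
Name = ℕ

Var : Set
Var = ℕ

DefId : Set
DefId = ℕ

data VTerm : Set where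
  num  : ℕ → VTerm
  var  : Var → VTerm
  _⊕_  : VTerm → VTerm → VTerm

data Formula : Set where
  eq  : VTerm → VTerm → Formula
  lt  : VTerm → VTerm → Formula
  neg : Formula → Formula
  and : Formula → Formula → Formula
  or  : Formula → Formula → Formula
  imp : Formula → Formula → Formula
  all : Var → Formula → Formula
  ex  : Var → Formula → Formula

data Term : Set where
  nil  : Term
  inp  : Name → Var → Term → Term
  out  : Name → VTerm → Term → Term
  par  : Term → Term → Term
  res  : Name → Term → Term
  ite  : Formula → Term → Term
  call : DefId → List VTerm → Term

record Def : Set where
  constructor mkDef
  field
    params : List Var
    body   : Term
open Def public

-- a process term together with the (numbered) parametric definitions it uses;
-- call D ts refers to the D-th definition of the list
record Program : Set where
  constructor mkProg
  field
    defs : List Def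
    main : Term
open Program public

Env : Set
Env = Var → ℕ

_[_↦_] : Env → Var → ℕ → Env
(ρ [ x ↦ n ]) y = if x ≡ᵇ y then n else ρ y

evalV : Env → VTerm → ℕ
evalV ρ (num n) = n
evalV ρ (var x) = ρ x
evalV ρ (t ⊕ u) = evalV ρ t + evalV ρ u

⟦_⟧ : Formula → Env → Set
⟦ eq t u ⟧ ρ = evalV ρ t ≡ evalV ρ u
⟦ lt t u ⟧ ρ = evalV ρ t < evalV ρ u
⟦ neg φ ⟧ ρ = ¬ ⟦ φ ⟧ ρ
⟦ and φ ψ ⟧ ρ = ⟦ φ ⟧ ρ × ⟦ ψ ⟧ ρ
⟦ or φ ψ ⟧ ρ = ⟦ φ ⟧ ρ ⊎ ⟦ ψ ⟧ ρ
⟦ imp φ ψ ⟧ ρ = ⟦ φ ⟧ ρ → ⟦ ψ ⟧ ρ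
⟦ all x φ ⟧ ρ = (n : ℕ) → ⟦ φ ⟧ (ρ [ x ↦ n ])
⟦ ex x φ ⟧ ρ = Σ ℕ (λ n → ⟦ φ ⟧ (ρ [ x ↦ n ]))

-- ⊢ φ : Presburger arithmetic is complete, so provability of φ is truth of
-- (the universal closure of) φ in the standard model ℕ.
Provable : Formula → Set
Provable φ = (ρ : Env) → ⟦ φ ⟧ ρ

Sub : Set
Sub = List (Var × VTerm)

lookupSub : Sub → Var → Maybe VTerm
lookupSub [] x = nothing
lookupSub ((y , t) ∷ σ) x = if y ≡ᵇ x then just t else lookupSub σ x

dropSub : Var → Sub → Sub
dropSub x [] = []
dropSub x ((y , t) ∷ σ) = if y ≡ᵇ x then dropSub x σ else (y , t) ∷ dropSub x σ

substV : Sub → VTerm → VTerm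
substV σ (num n) = num n
substV σ (var x) with lookupSub σ x
... | just t  = t
... | nothing = var x
substV σ (t ⊕ u) = substV σ t ⊕ substV σ u

substVs : Sub → List VTerm → List VTerm
substVs σ [] = []
substVs σ (t ∷ ts) = substV σ t ∷ substVs σ ts

substF : Sub → Formula → Formula
substF σ (eq t u) = eq (substV σ t) (substV σ u)
substF σ (lt t u) = lt (substV σ t) (substV σ u)
substF σ (neg φ) = neg (substF σ φ)
substF σ (and φ ψ) = and (substF σ φ) (substF σ ψ)
substF σ (or φ ψ) = or (substF σ φ) (substF σ ψ)
substF σ (imp φ ψ) = imp (substF σ φ) (substF σ ψ)
substF σ (all x φ) = all x (substF (dropSub x σ) φ)
substF σ (ex x φ) = ex x (substF (dropSub x σ) φ)

substT : Sub → Term → Term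
substT σ nil = nil
substT σ (inp a x T) = inp a x (substT (dropSub x σ) T)
substT σ (out a t T) = out a (substV σ t) (substT σ T)
substT σ (par T U) = par (substT σ T) (substT σ U)
substT σ (res c T) = res c (substT σ T)
substT σ (ite φ T) = ite (substF σ φ) (substT σ T)
substT σ (call D ts) = call D (substVs σ ts)

data Act : Set where
  τ   : Act
  inA : Name → ℕ → Act
  outA : Name → ℕ → Act

NotOn : Name → Act → Set
NotOn c τ = ⊤
NotOn c (inA a i) = a ≢ c
NotOn c (outA a i) = a ≢ c

lookupDef : List Def → DefId → Maybe Def
lookupDef [] D = nothing
lookupDef (d ∷ Δ) zero = just d
lookupDef (d ∷ Δ) (suc D) = lookupDef Δ D

data Step (Δ : List Def) : Term → Act → Term → Set where
  s-inp  : ∀ {a x T} (i : ℕ) → Step Δ (inp a x T) (inA a i) (substT ((x , num i) ∷ []) T)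
  s-out  : ∀ {a t T} (i : ℕ) → Provable (eq t (num i)) → Step Δ (out a t T) (outA a i) T
  s-parl : ∀ {T T' U α} → Step Δ T α T' → Step Δ (par T U) α (par T' U)
  s-parr : ∀ {T U U' α} → Step Δ U α U' → Step Δ (par T U) α (par T U')
  s-coml : ∀ {T T' U U' a i} → Step Δ T (inA a i) T' → Step Δ U (outA a i) U' →
           Step Δ (par T U) τ (par T' U')
  s-comr : ∀ {T T' U U' a i} → Step Δ T (outA a i) T' → Step Δ U (inA a i) U' →
           Step Δ (par T U) τ (par T' U')
  s-res  : ∀ {c T T' α} → NotOn c α → Step Δ T α T' → Step Δ (res c T) α (res c T')
  s-ite  : ∀ {φ T T' α} → Provable φ → Step Δ T α T' → Step Δ (ite φ T) α T'
  s-call : ∀ {D ts d T' α} → lookupDef Δ D ≡ just d → length ts ≡ length (params d) →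
           Step Δ (substT (zip (params d) ts) (body d)) α T' → Step Δ (call D ts) α T'

_⊢_⟹_ : List Def → Term → Term → Set
Δ ⊢ T ⟹ T' = Star (λ U U' → Step Δ U τ U') T T'

Unobservable : Program → Set
Unobservable P = ¬ (Σ Term λ P' → Σ Act λ α → Σ Term λ P'' →
  (defs P ⊢ main P ⟹ P') × (α ≢ τ) × Step (defs P) P' α P'')

-- Processes: terms without free variables (definition bodies may only use
-- their parameters)

data WFV (Γ : List Var) : VTerm → Set where
  w-num : ∀ {n} → WFV Γ (num n)
  w-var : ∀ {x} → x ∈ Γ → WFV Γ (var x)
  w-add : ∀ {t u} → WFV Γ t → WFV Γ u → WFV Γ (t ⊕ u)

data WFF (Γ : List Var) : Formula → Set where
  w-eq  : ∀ {t u} → WFV Γ t → WFV Γ u → WFF Γ (eq t u)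
  w-lt  : ∀ {t u} → WFV Γ t → WFV Γ u → WFF Γ (lt t u)
  w-neg : ∀ {φ} → WFF Γ φ → WFF Γ (neg φ)
  w-and : ∀ {φ ψ} → WFF Γ φ → WFF Γ ψ → WFF Γ (and φ ψ)
  w-or  : ∀ {φ ψ} → WFF Γ φ → WFF Γ ψ → WFF Γ (or φ ψ)
  w-imp : ∀ {φ ψ} → WFF Γ φ → WFF Γ ψ → WFF Γ (imp φ ψ)
  w-all : ∀ {x φ} → WFF (x ∷ Γ) φ → WFF Γ (all x φ)
  w-ex  : ∀ {x φ} → WFF (x ∷ Γ) φ → WFF Γ (ex x φ)

data WFT (Γ : List Var) : Term → Set where
  w-nil  : WFT Γ nil
  w-inp  : ∀ {a x T} → WFT (x ∷ Γ) T → WFT Γ (inp a x T)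
  w-out  : ∀ {a t T} → WFV Γ t → WFT Γ T → WFT Γ (out a t T)
  w-par  : ∀ {T U} → WFT Γ T → WFT Γ U → WFT Γ (par T U)
  w-res  : ∀ {c T} → WFT Γ T → WFT Γ (res c T)
  w-ite  : ∀ {φ T} → WFF Γ φ → WFT Γ T → WFT Γ (ite φ T)
  w-call : ∀ {D ts} → All (WFV Γ) ts → WFT Γ (call D ts)

IsProcess : Program → Set
IsProcess P = WFT [] (main P) × All (λ d → WFT (params d) (body d)) (defs P)

-- bijection ℕ × ℕ → ℕ
pair : ℕ → ℕ → ℕ
pair m n = 2 ^ m * (2 * n + 1) ∸ 1

encV : VTerm → ℕ
encV (num n) = pair 0 n
encV (var x) = pair 1 x
encV (t ⊕ u) = pair 2 (pair (encV t) (encV u))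

encVs : List VTerm → ℕ
encVs [] = 0
encVs (t ∷ ts) = suc (pair (encV t) (encVs ts))

encNs : List ℕ → ℕ
encNs [] = 0
encNs (x ∷ xs) = suc (pair x (encNs xs))

encF : Formula → ℕ
encF (eq t u) = pair 0 (pair (encV t) (encV u))
encF (lt t u) = pair 1 (pair (encV t) (encV u))
encF (neg φ) = pair 2 (encF φ)
encF (and φ ψ) = pair 3 (pair (encF φ) (encF ψ))
encF (or φ ψ) = pair 4 (pair (encF φ) (encF ψ))
encF (imp φ ψ) = pair 5 (pair (encF φ) (encF ψ))
encF (all x φ) = pair 6 (pair x (encF φ))
encF (ex x φ) = pair 7 (pair x (encF φ))

encT : Term → ℕ
encT nil = pair 0 0
encT (inp a x T) = pair 1 (pair a (pair x (encT T)))
encT (out a t T) = pair 2 (pair a (pair (encV t) (encT T)))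
encT (par T U) = pair 3 (pair (encT T) (encT U))
encT (res c T) = pair 4 (pair c (encT T))
encT (ite φ T) = pair 5 (pair (encF φ) (encT T))
encT (call D ts) = pair 6 (pair D (encVs ts))

encDefs : List Def → ℕ
encDefs [] = 0
encDefs (d ∷ Δ) = suc (pair (pair (encNs (params d)) (encT (body d))) (encDefs Δ))

⌜_⌝ : Program → ℕ
⌜ P ⌝ = pair (encDefs (defs P)) (encT (main P))

data Rec : ℕ → Set where
  zer  : Rec 0
  sc   : Rec 1
  proj : ∀ {n} → Fin n → Rec n
  comp : ∀ {m n} → Rec m → Vec (Rec n) m → Rec n
  prec : ∀ {n} → Rec n → Rec (suc (suc n)) → Rec (suc n)
  mu   : ∀ {n} → Rec (suc n) → Rec n

mutual
  data _▹_⇓_ : ∀ {n} → Rec n → Vec ℕ n → ℕ → Set where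
    e-zer  : zer ▹ [] ⇓ 0
    e-sc   : ∀ {x} → sc ▹ (x ∷ []) ⇓ suc x
    e-proj : ∀ {n} {i : Fin n} {xs} → proj i ▹ xs ⇓ lookup xs i
    e-comp : ∀ {m n} {f : Rec m} {gs : Vec (Rec n) m} {xs ys y} →
             gs ▹▹ xs ⇓ ys → f ▹ ys ⇓ y → comp f gs ▹ xs ⇓ y
    e-prz  : ∀ {n} {f : Rec n} {g xs y} → f ▹ xs ⇓ y → prec f g ▹ (0 ∷ xs) ⇓ y
    e-prs  : ∀ {n} {f : Rec n} {g xs k r y} → prec f g ▹ (k ∷ xs) ⇓ r →
             g ▹ (k ∷ r ∷ xs) ⇓ y → prec f g ▹ (suc k ∷ xs) ⇓ y
    e-mu   : ∀ {n} {f : Rec (suc n)} {xs k} → f ▹ (k ∷ xs) ⇓ 0 →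
             (∀ j → j < k → Σ ℕ λ v → f ▹ (j ∷ xs) ⇓ suc v) → mu f ▹ xs ⇓ k

  data _▹▹_⇓_ : ∀ {m n} → Vec (Rec n) m → Vec ℕ n → Vec ℕ m → Set where
    e-[] : ∀ {n} {xs : Vec ℕ n} → [] ▹▹ xs ⇓ []
    e-∷  : ∀ {m n} {g : Rec n} {gs : Vec (Rec n) m} {xs y ys} →
           g ▹ xs ⇓ y → gs ▹▹ xs ⇓ ys → (g ∷ gs) ▹▹ xs ⇓ (y ∷ ys)

DecidableProcessProperty : (Program → Set) → Set
DecidableProcessProperty Q = Σ (Rec 1) λ f → (P : Program) → IsProcess P →
  (Q P → f ▹ (⌜ P ⌝ ∷ []) ⇓ 1) × (¬ Q P → f ▹ (⌜ P ⌝ ∷ []) ⇓ 0)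

module Submission where

-- Suppose a total μ-recursive f decided it on Gödel indices.  We build a
-- process P = D₀(⌜Δ⌝) whose definitions Δ compute y = f(⌜P⌝), by unfolding
-- parametric definitions and testing Presburger equalities, and then emit
-- ā(0) iff y = 1.  So P is observable iff f declares it unobservable.

open import Defs
open import Data.Nat using (ℕ; zero; suc; _+_; _*_; _∸_; _^_; _≤_; _<_; _≡ᵇ_; s≤s; _≟_)
open import Data.Nat.Properties
  using (+-suc; +-identityʳ; +-comm; +-assoc; ≡ᵇ⇒≡; ≡⇒≡ᵇ; m≢1+m+n; m≤n+m; ≤-refl; <⇒≤; <-irrefl)
open import Data.Bool using (true; false)
open import Data.Bool.Properties using (T-≡; ¬-not)
open import Data.Fin using (Fin; toℕ; _↑ˡ_) renaming (zero to fzero; suc to fsuc)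
open import Data.Vec using (Vec; []; _∷_; lookup; tabulate; map; _++_; take; drop)
open import Data.Vec.Properties using (map-++; lookup-++ˡ; tabulate∘lookup; tabulate-∘; take-map; drop-map)
open import Data.List as List using (List; []; _∷_; length; zip)
open import Data.List.Properties using (length-++)
open import Data.List.Membership.Propositional using (_∈_)
open import Data.List.Relation.Unary.Any using (here; there)
open import Data.List.Relation.Unary.All using (All; []; _∷_)
open import Data.Maybe using (Maybe; just; nothing)
open import Data.Maybe.Properties using (just-injective)
open import Data.Product using (Σ; _×_; _,_; proj₁; proj₂)
open import Data.Empty using (⊥-elim)
open import Function.Bundles using (_⇔_; mk⇔; Equivalence)
open import Function.Construct.Composition using (_⇔-∘_)
open import Function.Construct.Identity using (⇔-id)
open import Relation.Nullary using (¬_; yes; no)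
open import Relation.Binary.PropositionalEquality
  using (_≡_; _≢_; refl; sym; trans; cong; cong₂; subst; module ≡-Reasoning)
open import Relation.Binary.Construct.Closure.ReflexiveTransitive using (ε; _◅_)

open Equivalence using (to; from)

data Closed : VTerm → ℕ → Set where
  closed-num : ∀ {n} → Closed (num n) n
  closed-add : ∀ {t u a c} → Closed t a → Closed u c → Closed (t ⊕ u) (a + c)

data AllClosed : ∀ {q} → List VTerm → Vec ℕ q → Set where
  []  : AllClosed [] []
  _∷_ : ∀ {q t a us} {vs : Vec ℕ q} → Closed t a → AllClosed us vs → AllClosed (t ∷ us) (a ∷ vs)

closed-eval : ∀ {t a} → Closed t a → ∀ ρ → evalV ρ t ≡ a
closed-eval closed-num       ρ = refl
closed-eval (closed-add c d) ρ = cong₂ _+_ (closed-eval c ρ) (closed-eval d ρ)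

allClosed-length : ∀ {q us} {vs : Vec ℕ q} → AllClosed us vs → length us ≡ q
allClosed-length []       = refl
allClosed-length (_ ∷ cs) = cong suc (allClosed-length cs)

-- An equation between closed terms is provable iff their values agree;
-- this is what lets a conditional of VPC test equalities of numbers.
closed-eq : ∀ {t u a c} → Closed t a → Closed u c → Provable (eq t u) ⇔ (a ≡ c)
closed-eq {t} {u} ct cu = mk⇔
  (λ ⊢t=u → trans (sym (closed-eval ct ρ₀)) (trans (⊢t=u ρ₀) (closed-eval cu ρ₀)))
  (λ a≡c ρ → trans (closed-eval ct ρ) (trans a≡c (sym (closed-eval cu ρ))))
  where
  ρ₀ : Env
  ρ₀ _ = 0

closed-neq : ∀ {t u a c} → Closed t a → Closed u c → Provable (neg (eq t u)) ⇔ (a ≢ c)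
closed-neq ct cu = mk⇔
  (λ ⊢t≠u a≡c → ⊢t≠u (λ _ → 0) (from (closed-eq ct cu) a≡c (λ _ → 0)))
  (λ a≢c ρ t=u → a≢c (trans (sym (closed-eval ct ρ)) (trans t=u (closed-eval cu ρ))))

-- The definitions built below use only a few forms of body, described by a
-- small syntax over numbered parameters and embedded into VPC terms.

data Val (p : ℕ) : Set where
  param : Fin p → Val p
  lit   : ℕ → Val p
  _+ᵛ_  : Val p → Val p → Val p

data Body (p : ℕ) : Set where
  goto   : ∀ {q} → DefId → Vec (Val p) q → Body p
  branch : Val p → Val p → Body p → Body p → Body p
  emit   : Body p
  stop   : Body p

StructDef : Set
StructDef = Σ ℕ Body

varsFrom : ℕ → ℕ → List Var
varsFrom k zero    = []
varsFrom k (suc p) = k ∷ varsFrom (suc k) p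

length-varsFrom : ∀ k p → length (varsFrom k p) ≡ p
length-varsFrom k zero    = refl
length-varsFrom k (suc p) = cong suc (length-varsFrom (suc k) p)

⌊_⌋ᵛ : ∀ {p} → Val p → VTerm
⌊ param i ⌋ᵛ = var (toℕ i)
⌊ lit n ⌋ᵛ   = num n
⌊ u +ᵛ v ⌋ᵛ  = ⌊ u ⌋ᵛ ⊕ ⌊ v ⌋ᵛ

⌊_⌋ᵛˢ : ∀ {p q} → Vec (Val p) q → List VTerm
⌊ [] ⌋ᵛˢ     = []
⌊ v ∷ vs ⌋ᵛˢ = ⌊ v ⌋ᵛ ∷ ⌊ vs ⌋ᵛˢ

-- "if u = v then A else C" is the parallel of two complementary guards.
⌊_⌋ᵇ : ∀ {p} → Body p → Term
⌊ goto D as ⌋ᵇ       = call D ⌊ as ⌋ᵛˢ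
⌊ branch u v A C ⌋ᵇ  =
  par (ite (eq ⌊ u ⌋ᵛ ⌊ v ⌋ᵛ) ⌊ A ⌋ᵇ) (ite (neg (eq ⌊ u ⌋ᵛ ⌊ v ⌋ᵛ)) ⌊ C ⌋ᵇ)
⌊ emit ⌋ᵇ            = out 0 (num 0) nil
⌊ stop ⌋ᵇ            = nil

embed : StructDef → Def
embed (p , b) = mkDef (varsFrom 0 p) ⌊ b ⌋ᵇ

eval : ∀ {p} → Vec ℕ p → Val p → ℕ
eval vs (param i) = lookup vs i
eval vs (lit n)   = n
eval vs (u +ᵛ v)  = eval vs u + eval vs v

v₀ : ∀ {p} → Val (suc p)
v₀ = param fzero

v₁ : ∀ {p} → Val (2 + p)
v₁ = param (fsuc fzero)

v₂ : ∀ {p} → Val (3 + p)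
v₂ = param (fsuc (fsuc fzero))

allParams : ∀ {p} → Vec (Val p) p
allParams = tabulate param

after : ∀ j {p} → Vec (Val (j + p)) p
after j = drop j allParams

-- With parameter values laid out as pre ++ xs ++ es (|pre| = j, |xs| = n),
-- window j n selects xs and rest j n selects es.
window : ∀ j n {m} → Vec (Val (j + (n + m))) n
window j n = take n (after j)

rest : ∀ j n {m} → Vec (Val (j + (n + m))) m
rest j n = drop n (after j)

take-++ : ∀ {A : Set} {m n} (xs : Vec A m) (ys : Vec A n) → take m (xs ++ ys) ≡ xs
take-++ []       ys = refl
take-++ (x ∷ xs) ys = cong (x ∷_) (take-++ xs ys)

drop-++ : ∀ {A : Set} {m n} (xs : Vec A m) (ys : Vec A n) → drop m (xs ++ ys) ≡ ys
drop-++ []       ys = refl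
drop-++ (x ∷ xs) ys = drop-++ xs ys

ev-all : ∀ {p} (vs : Vec ℕ p) → map (eval vs) allParams ≡ vs
ev-all vs = trans (sym (tabulate-∘ (eval vs) param)) (tabulate∘lookup vs)

ev-after : ∀ {j p} (pre : Vec ℕ j) (vs : Vec ℕ p) → map (eval (pre ++ vs)) (after j) ≡ vs
ev-after {j} pre vs = begin
  map (eval (pre ++ vs)) (drop j allParams)  ≡⟨ sym (drop-map (eval (pre ++ vs)) j allParams) ⟩
  drop j (map (eval (pre ++ vs)) allParams)  ≡⟨ cong (drop j) (ev-all (pre ++ vs)) ⟩
  drop j (pre ++ vs)                         ≡⟨ drop-++ pre vs ⟩
  vs                                         ∎
  where open ≡-Reasoning

ev-window : ∀ {j n m} (pre : Vec ℕ j) (xs : Vec ℕ n) (es : Vec ℕ m) →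
            map (eval (pre ++ xs ++ es)) (window j n) ≡ xs
ev-window {j} {n} pre xs es = begin
  map (eval (pre ++ xs ++ es)) (take n (after j))  ≡⟨ sym (take-map (eval (pre ++ xs ++ es)) n (after j)) ⟩
  take n (map (eval (pre ++ xs ++ es)) (after j))  ≡⟨ cong (take n) (ev-after pre (xs ++ es)) ⟩
  take n (xs ++ es)                                ≡⟨ take-++ xs es ⟩
  xs                                               ∎
  where open ≡-Reasoning

ev-rest : ∀ {j n m} (pre : Vec ℕ j) (xs : Vec ℕ n) (es : Vec ℕ m) →
          map (eval (pre ++ xs ++ es)) (rest j n) ≡ es
ev-rest {j} {n} pre xs es = begin
  map (eval (pre ++ xs ++ es)) (drop n (after j))  ≡⟨ sym (drop-map (eval (pre ++ xs ++ es)) n (after j)) ⟩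
  drop n (map (eval (pre ++ xs ++ es)) (after j))  ≡⟨ cong (drop n) (ev-after pre (xs ++ es)) ⟩
  drop n (xs ++ es)                                ≡⟨ drop-++ xs es ⟩
  es                                               ∎
  where open ≡-Reasoning

ev-++ : ∀ {p q r} {vs : Vec ℕ p} (as : Vec (Val p) q) (bs : Vec (Val p) r) {zs zs'} →
        map (eval vs) as ≡ zs → map (eval vs) bs ≡ zs' → map (eval vs) (as ++ bs) ≡ zs ++ zs'
ev-++ {vs = vs} as bs e e' = trans (map-++ (eval vs) as bs) (cong₂ _++_ e e')

≡ᵇ-true : ∀ {m n} → m ≡ n → (m ≡ᵇ n) ≡ true
≡ᵇ-true {m} {n} m≡n = to T-≡ (≡⇒≡ᵇ m n m≡n)

≡ᵇ-false : ∀ {m n} → m ≢ n → (m ≡ᵇ n) ≡ false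
≡ᵇ-false {m} {n} m≢n = ¬-not (λ e → m≢n (≡ᵇ⇒≡ m n (from T-≡ e)))

lookup-param : ∀ {p us} {vs : Vec ℕ p} → AllClosed us vs → (k : ℕ) (i : Fin p) →
  Σ VTerm λ u → lookupSub (zip (varsFrom k p) us) (k + toℕ i) ≡ just u × Closed u (lookup vs i)
lookup-param {us = t ∷ _} (c ∷ _) k fzero rewrite ≡ᵇ-true (sym (+-identityʳ k)) = t , refl , c
lookup-param {suc p} {us = t ∷ us} (_ ∷ cs) k (fsuc i)
  rewrite ≡ᵇ-false {k} {k + suc (toℕ i)} (λ e → m≢1+m+n k (trans e (+-suc k (toℕ i))))
  with lookup-param cs (suc k) i
... | u , found , c =
  u , subst (λ x → lookupSub (zip (varsFrom (suc k) p) us) x ≡ just u) (sym (+-suc k (toℕ i))) found , c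

substV-var : ∀ σ x {u} → lookupSub σ x ≡ just u → substV σ (var x) ≡ u
substV-var σ x found with lookupSub σ x
substV-var σ x refl | just _ = refl

subst-val : ∀ {p us} {vs : Vec ℕ p} → AllClosed us vs → (v : Val p) →
            Closed (substV (zip (varsFrom 0 p) us) ⌊ v ⌋ᵛ) (eval vs v)
subst-val {p} {us} cs (param i) with lookup-param cs 0 i
... | u , found , c = subst (λ t → Closed t _) (sym (substV-var (zip (varsFrom 0 p) us) (toℕ i) found)) c
subst-val cs (lit n)  = closed-num
subst-val cs (u +ᵛ v) = closed-add (subst-val cs u) (subst-val cs v)

subst-vals : ∀ {p q us} {vs : Vec ℕ p} → AllClosed us vs → (as : Vec (Val p) q) →
             AllClosed (substVs (zip (varsFrom 0 p) us) ⌊ as ⌋ᵛˢ) (map (eval vs) as)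
subst-vals cs []       = []
subst-vals cs (a ∷ as) = subst-val cs a ∷ subst-vals cs as

varsFrom-∈ : ∀ k p (i : Fin p) → k + toℕ i ∈ varsFrom k p
varsFrom-∈ k (suc p) fzero    = here (+-identityʳ k)
varsFrom-∈ k (suc p) (fsuc i) =
  there (subst (_∈ varsFrom (suc k) p) (sym (+-suc k (toℕ i))) (varsFrom-∈ (suc k) p i))

wf-val : ∀ {p} (v : Val p) → WFV (varsFrom 0 p) ⌊ v ⌋ᵛ
wf-val {p} (param i) = w-var (varsFrom-∈ 0 p i)
wf-val (lit n)       = w-num
wf-val (u +ᵛ v)      = w-add (wf-val u) (wf-val v)

wf-vals : ∀ {p q} (as : Vec (Val p) q) → All (WFV (varsFrom 0 p)) ⌊ as ⌋ᵛˢ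
wf-vals []       = []
wf-vals (a ∷ as) = wf-val a ∷ wf-vals as

wf-body : ∀ {p} (b : Body p) → WFT (varsFrom 0 p) ⌊ b ⌋ᵇ
wf-body (goto D as)      = w-call (wf-vals as)
wf-body (branch u v A C) =
  w-par (w-ite (w-eq (wf-val u) (wf-val v)) (wf-body A))
        (w-ite (w-neg (w-eq (wf-val u) (wf-val v))) (wf-body C))
wf-body emit             = w-out w-num w-nil
wf-body stop             = w-nil

wf-embed : ∀ Γ → All (λ d → WFT (params d) (body d)) (List.map embed Γ)
wf-embed []             = []
wf-embed ((p , b) ∷ Γ) = wf-body b ∷ wf-embed Γ

lookupAt : {A : Set} → List A → ℕ → Maybe A
lookupAt []       i       = nothing
lookupAt (x ∷ xs) zero    = just x
lookupAt (x ∷ xs) (suc i) = lookupAt xs i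

lookupAt-++ˡ : ∀ {A : Set} (xs ys : List A) i {s} → lookupAt xs i ≡ just s → lookupAt (xs List.++ ys) i ≡ just s
lookupAt-++ˡ []       ys i       ()
lookupAt-++ˡ (x ∷ xs) ys zero    found = found
lookupAt-++ˡ (x ∷ xs) ys (suc i) found = lookupAt-++ˡ xs ys i found

lookupAt-++ʳ : ∀ {A : Set} (xs ys : List A) i → lookupAt (xs List.++ ys) (length xs + i) ≡ lookupAt ys i
lookupAt-++ʳ []       ys i = refl
lookupAt-++ʳ (x ∷ xs) ys i = lookupAt-++ʳ xs ys i

lookupAt-length : ∀ {A : Set} (xs : List A) {y ys} → lookupAt (xs List.++ y ∷ ys) (length xs) ≡ just y
lookupAt-length []       = refl
lookupAt-length (x ∷ xs) = lookupAt-length xs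

lookupDef-embed : ∀ Γ D {s} → lookupAt Γ D ≡ just s → lookupDef (List.map embed Γ) D ≡ just (embed s)
lookupDef-embed []      D       ()
lookupDef-embed (_ ∷ Γ) zero    refl  = refl
lookupDef-embed (_ ∷ Γ) (suc D) found = lookupDef-embed Γ D found

record CodeAt (Γ : List StructDef) (b : ℕ) (ds : List StructDef) : Set where
  constructor codeAt
  field placed : ∀ i {s} → lookupAt ds i ≡ just s → lookupAt Γ (i + b) ≡ just s
open CodeAt public

code-whole : ∀ Γ → CodeAt Γ 0 Γ
code-whole Γ = codeAt λ i {s} found → subst (λ x → lookupAt Γ x ≡ just s) (sym (+-identityʳ i)) found

code-tail : ∀ {Γ b d ds} → CodeAt Γ b (d ∷ ds) → CodeAt Γ (suc b) ds
code-tail {Γ} {b} H = codeAt λ i {s} found →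
  subst (λ x → lookupAt Γ x ≡ just s) (sym (+-suc i b)) (placed H (suc i) found)

code-left : ∀ {Γ b} xs {ys} → CodeAt Γ b (xs List.++ ys) → CodeAt Γ b xs
code-left xs {ys} H = codeAt λ i found → placed H i (lookupAt-++ˡ xs ys i found)

code-right : ∀ {Γ b} xs {ys l} → length xs ≡ l → CodeAt Γ b (xs List.++ ys) → CodeAt Γ (l + b) ys
code-right {Γ} {b} xs {ys} refl H = codeAt λ i {s} found →
  subst (λ x → lookupAt Γ x ≡ just s) (trans (cong (_+ b) (+-comm (length xs) i)) (+-assoc i (length xs) b))
    (placed H (length xs + i) (trans (lookupAt-++ʳ xs ys i) found))

-- Up to the immediate actions a term can perform, a call of structured code
-- with closed arguments behaves as the body it finally reaches.

module Behaviour (Γ : List StructDef) where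

  Δ : List Def
  Δ = List.map embed Γ

  CanDo : Term → Act → Set
  CanDo T α = Σ Term (Step Δ T α)

  -- T ≈ U : T and U can perform exactly the same immediate actions.
  -- This is all we need: observability only asks which actions occur.
  _≈_ : Term → Term → Set
  T ≈ U = ∀ α → CanDo T α ⇔ CanDo U α

  ≈-refl : ∀ {T} → T ≈ T
  ≈-refl α = ⇔-id _

  ≈-trans : ∀ {T U W} → T ≈ U → U ≈ W → T ≈ W
  ≈-trans T≈U U≈W α = U≈W α ⇔-∘ T≈U α

  Inert : Term → Set
  Inert T = ∀ {α T'} → ¬ Step Δ T α T'

  ite-true : ∀ {φ A} → Provable φ → ite φ A ≈ A
  ite-true ⊢φ α = mk⇔ (λ { (_ , s-ite _ s) → _ , s }) (λ { (_ , s) → _ , s-ite ⊢φ s })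

  ite-false : ∀ {φ A} → ¬ Provable φ → Inert (ite φ A)
  ite-false ⊬φ (s-ite ⊢φ _) = ⊬φ ⊢φ

  par-inertʳ : ∀ {A C} → Inert C → par A C ≈ A
  par-inertʳ {A} {C} inert α = mk⇔ left (λ { (_ , s) → _ , s-parl s })
    where
    left : CanDo (par A C) α → CanDo A α
    left (_ , s-parl s)   = _ , s
    left (_ , s-parr s)   = ⊥-elim (inert s)
    left (_ , s-coml _ s) = ⊥-elim (inert s)
    left (_ , s-comr _ s) = ⊥-elim (inert s)

  par-inertˡ : ∀ {A C} → Inert A → par A C ≈ C
  par-inertˡ {A} {C} inert α = mk⇔ right (λ { (_ , s) → _ , s-parr s })
    where
    right : CanDo (par A C) α → CanDo C α
    right (_ , s-parl s)   = ⊥-elim (inert s)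
    right (_ , s-parr s)   = _ , s
    right (_ , s-coml s _) = ⊥-elim (inert s)
    right (_ , s-comr s _) = ⊥-elim (inert s)

  branch-behaves : ∀ {t u a c A C T} → Closed t a → Closed u c →
                   (a ≡ c → A ≈ T) → (a ≢ c → C ≈ T) →
                   par (ite (eq t u) A) (ite (neg (eq t u)) C) ≈ T
  branch-behaves {a = a} {c} ct cu then else with a ≟ c
  ... | yes a≡c = ≈-trans (par-inertʳ (ite-false (λ ⊢≠ → to (closed-neq ct cu) ⊢≠ a≡c)))
                          (≈-trans (ite-true (from (closed-eq ct cu) a≡c)) (then a≡c))
  ... | no  a≢c = ≈-trans (par-inertˡ (ite-false (λ ⊢= → a≢c (to (closed-eq ct cu) ⊢=))))
                          (≈-trans (ite-true (from (closed-neq ct cu) a≢c)) (else a≢c))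

  call-unfold : ∀ {D d us} → lookupDef Δ D ≡ just d → length us ≡ length (params d) →
                call D us ≈ substT (zip (params d) us) (body d)
  call-unfold {D} {d} {us} found arity α = mk⇔ unfold (λ { (_ , s) → _ , s-call found arity s })
    where
    unfold : CanDo (call D us) α → CanDo (substT (zip (params d) us) (body d)) α
    unfold (_ , s-call found' _ s) =
      _ , subst (λ d' → Step Δ (substT (zip (params d') us) (body d')) α _)
                (just-injective (trans (sym found') found)) s

  ⟪_,_⟫≈_ : ∀ {q} → DefId → Vec ℕ q → Term → Set
  ⟪ D , zs ⟫≈ T = ∀ us → AllClosed us zs → call D us ≈ T

  ≈-args : ∀ {q D T} {zs zs' : Vec ℕ q} → zs ≡ zs' → ⟪ D , zs' ⟫≈ T → ⟪ D , zs ⟫≈ T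
  ≈-args refl h = h

  Behaves : ∀ {p} → Body p → Vec ℕ p → Term → Set
  Behaves (goto D as) vs T      = ⟪ D , map (eval vs) as ⟫≈ T
  Behaves (branch u v A C) vs T =
    (eval vs u ≡ eval vs v → Behaves A vs T) × (eval vs u ≢ eval vs v → Behaves C vs T)
  Behaves emit vs T             = out 0 (num 0) nil ≈ T
  Behaves stop vs T             = nil ≈ T

  body-behaves : ∀ {p us T} {vs : Vec ℕ p} (b : Body p) → Behaves b vs T → AllClosed us vs →
                 substT (zip (varsFrom 0 p) us) ⌊ b ⌋ᵇ ≈ T
  body-behaves (goto D as) h cs              = h _ (subst-vals cs as)
  body-behaves (branch u v A C) (hA , hC) cs =
    branch-behaves (subst-val cs u) (subst-val cs v)
      (λ e → body-behaves A (hA e) cs) (λ ne → body-behaves C (hC ne) cs)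
  body-behaves emit h cs                     = h
  body-behaves stop h cs                     = h

  unfold-def : ∀ {D p T} {b : Body p} → lookupAt Γ D ≡ just (p , b) → (vs : Vec ℕ p) →
               Behaves b vs T → ⟪ D , vs ⟫≈ T
  unfold-def {D} {p} {b = b} found vs h us cs =
    ≈-trans (call-unfold (lookupDef-embed Γ D found) (trans (allClosed-length cs) (sym (length-varsFrom 0 p))))
            (body-behaves b h cs)

  follow : ∀ {D D' p q T} {as : Vec (Val p) q} {zs} → lookupAt Γ D ≡ just (p , goto D' as) →
           (vs : Vec ℕ p) → map (eval vs) as ≡ zs → ⟪ D' , zs ⟫≈ T → ⟪ D , vs ⟫≈ T
  follow found vs values h = unfold-def found vs (≈-args values h)

  inert-unobservable : ∀ {M} → Inert M → Unobservable (mkProg Δ M)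
  inert-unobservable inert (_ , _ , _ , ε , _ , s)     = inert s
  inert-unobservable inert (_ , _ , _ , s ◅ _ , _ , _) = inert s

  emitting-observable : ∀ {M a i} → CanDo M (outA a i) → ¬ Unobservable (mkProg Δ M)
  emitting-observable (M' , s) unobservable = unobservable (_ , outA _ _ , M' , ε , (λ ()) , s)

mutual
  size : ∀ {n} → Rec n → ℕ
  size zer         = 1
  size sc          = 1
  size (proj i)    = 1
  size (comp f gs) = sizes gs + size f
  size (prec f g)  = 4 + (size f + size g)
  size (mu f)      = 3 + size f

  sizes : ∀ {n k} → Vec (Rec n) k → ℕ
  sizes []       = 1
  sizes (g ∷ gs) = 3 + (size g + sizes gs)

-- compile g m K b is code to be placed at address b.  Called with
-- xs ++ es (xs the n inputs of g, es m further values), it jumps to K with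
-- g(xs) ∷ es.  The code of a subprogram is placed after the headers.
mutual
  compile : ∀ {n} → Rec n → (m K b : ℕ) → List StructDef
  compile zer m K b = (m , goto K (lit 0 ∷ allParams)) ∷ []
  compile sc m K b  = (suc m , goto K (lit 1 +ᵛ v₀ ∷ after 1)) ∷ []
  compile {n} (proj i) m K b = (n + m , goto K (param (i ↑ˡ m) ∷ rest 0 n)) ∷ []
  compile (comp f gs) m K b = compiles gs m (sizes gs + b) b List.++ compile f m K (sizes gs + b)
  -- b: run f on xs, keeping k ∷ xs ++ es;  b+1: enter the loop with j = 0;
  -- b+2, in state r ∷ j ∷ k ∷ xs ++ es: return r if j = k, else run g on
  -- j ∷ r ∷ xs;  b+3: continue the loop with g's result and j + 1.
  compile {suc n} (prec f g) m K b =
      (suc (n + m) , goto (4 + b) (window 1 n ++ allParams))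
    ∷ (2 + (n + m) , goto (2 + b) (v₀ ∷ lit 0 ∷ after 1))
    ∷ (3 + (n + m) , branch v₁ v₂ (goto K (v₀ ∷ rest 3 n))
                                  (goto (size f + (4 + b)) ((v₁ ∷ v₀ ∷ window 3 n) ++ (v₁ ∷ after 2))))
    ∷ (3 + (n + m) , goto (2 + b) (v₀ ∷ lit 1 +ᵛ v₁ ∷ after 2))
    ∷ compile f (suc (n + m)) (1 + b) (4 + b) List.++ compile g (2 + (n + m)) (3 + b) (size f + (4 + b))
  -- b: start with j = 0;  b+1: run f on j ∷ xs, keeping j ∷ xs ++ es;
  -- b+2, in state v ∷ j ∷ xs ++ es: return j if v = 0, else retry with j + 1.
  compile {n} (mu f) m K b =
      (n + m , goto (1 + b) (lit 0 ∷ allParams))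
    ∷ (suc (n + m) , goto (3 + b) ((v₀ ∷ window 1 n) ++ allParams))
    ∷ (2 + (n + m) , branch v₀ (lit 0) (goto K (v₁ ∷ rest 2 n)) (goto (1 + b) (lit 1 +ᵛ v₁ ∷ after 2)))
    ∷ compile f (suc (n + m)) (2 + b) (3 + b)

  -- compiles gs m K b: on xs ++ es jumps to K with gs(xs) ++ es.
  compiles : ∀ {n k} → Vec (Rec n) k → (m K b : ℕ) → List StructDef
  compiles {n} [] m K b = (n + m , goto K (rest 0 n)) ∷ []
  -- b: run g on xs;  b+1: run gs on xs, keeping y = g(xs) in front of es;
  -- b+2: move y in front of the results of gs.
  compiles {n} {suc k} (g ∷ gs) m K b =
      (n + m , goto (3 + b) (window 0 n ++ allParams))
    ∷ (suc (n + m) , goto (size g + (3 + b)) (window 1 n ++ (v₀ ∷ rest 1 n)))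
    ∷ (k + suc m , goto K (window k 1 ++ window 0 k ++ rest k 1))
    ∷ compile g (n + m) (1 + b) (3 + b) List.++ compiles gs (suc m) (2 + b) (size g + (3 + b))

mutual
  compile-length : ∀ {n} (g : Rec n) m K b → length (compile g m K b) ≡ size g
  compile-length zer m K b      = refl
  compile-length sc m K b       = refl
  compile-length (proj i) m K b = refl
  compile-length (comp f gs) m K b =
    trans (length-++ (compiles gs m (sizes gs + b) b))
          (cong₂ _+_ (compiles-length gs m _ b) (compile-length f m K _))
  compile-length {suc n} (prec f g) m K b =
    cong (4 +_) (trans (length-++ (compile f (suc (n + m)) (1 + b) (4 + b)))
                       (cong₂ _+_ (compile-length f _ _ _) (compile-length g _ _ _)))
  compile-length (mu f) m K b = cong (3 +_) (compile-length f _ _ _)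

  compiles-length : ∀ {n k} (gs : Vec (Rec n) k) m K b → length (compiles gs m K b) ≡ sizes gs
  compiles-length [] m K b           = refl
  compiles-length {n} (g ∷ gs) m K b =
    cong (3 +_) (trans (length-++ (compile g (n + m) (1 + b) (3 + b)))
                       (cong₂ _+_ (compile-length g _ _ _) (compiles-length gs _ _ _)))

module Soundness (Γ : List StructDef) (T : Term) where
  open Behaviour Γ

  Sim : ∀ {n} → Rec n → (m K b : ℕ) → Set
  Sim {n} g m K b = ∀ (xs : Vec ℕ n) (es : Vec ℕ m) {y} → g ▹ xs ⇓ y →
                    ⟪ K , y ∷ es ⟫≈ T → ⟪ b , xs ++ es ⟫≈ T

  Sims : ∀ {n k} → Vec (Rec n) k → (m K b : ℕ) → Set
  Sims {n} {k} gs m K b = ∀ (xs : Vec ℕ n) (es : Vec ℕ m) {ys : Vec ℕ k} → gs ▹▹ xs ⇓ ys →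
                          ⟪ K , ys ++ es ⟫≈ T → ⟪ b , xs ++ es ⟫≈ T

  sim-zer : ∀ {m K b} → CodeAt Γ b (compile zer m K b) → Sim zer m K b
  sim-zer H [] es e-zer h = follow (placed H 0 refl) es (cong (0 ∷_) (ev-all es)) h

  sim-sc : ∀ {m K b} → CodeAt Γ b (compile sc m K b) → Sim sc m K b
  sim-sc H (x ∷ []) es e-sc h = follow (placed H 0 refl) _ (cong (suc x ∷_) (ev-after (x ∷ []) es)) h

  sim-proj : ∀ {n m K b} {i : Fin n} → CodeAt Γ b (compile (proj i) m K b) → Sim (proj i) m K b
  sim-proj {i = i} H xs es e-proj h =
    follow (placed H 0 refl) _ (cong₂ _∷_ (lookup-++ˡ xs es i) (ev-rest [] xs es)) h

  sim-comp : ∀ {n k m K K' b} {f : Rec k} {gs : Vec (Rec n) k} →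
             Sims gs m K' b → Sim f m K K' → Sim (comp f gs) m K b
  sim-comp simgs simf xs es (e-comp Dgs Df) h = simgs xs es Dgs (simf _ es Df h)

  sim-prec : ∀ {n m K b} {f : Rec n} {g : Rec (2 + n)} → CodeAt Γ b (compile (prec f g) m K b) →
             Sim f (1 + (n + m)) (1 + b) (4 + b) → Sim g (2 + (n + m)) (3 + b) (size f + (4 + b)) →
             Sim (prec f g) m K b
  sim-prec {n} {m} {K} {b} {f} {g} H simf simg (k ∷ xs) es {y} D h = iterate D ≤-refl finish
    where
    LoopAt : ℕ → ℕ → Set
    LoopAt r j = ⟪ 2 + b , r ∷ j ∷ k ∷ xs ++ es ⟫≈ T

    finish : LoopAt y k
    finish = unfold-def (placed H 2 refl) _
      ((λ _ → ≈-args (cong (y ∷_) (ev-rest (y ∷ k ∷ k ∷ []) xs es)) h) , (λ k≢k → ⊥-elim (k≢k refl)))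

    start : ∀ {r} → f ▹ xs ⇓ r → LoopAt r 0 → ⟪ b , k ∷ xs ++ es ⟫≈ T
    start {r} Df hr =
      follow (placed H 0 refl) _ (ev-++ (window 1 n) allParams (ev-window (k ∷ []) xs es) (ev-all _))
        (simf xs (k ∷ xs ++ es) Df
          (follow (placed H 1 refl) _ (cong (λ zs → r ∷ 0 ∷ zs) (ev-after (r ∷ []) (k ∷ xs ++ es))) hr))

    step : ∀ {j r r'} → g ▹ (j ∷ r' ∷ xs) ⇓ r → j < k → LoopAt r (suc j) → LoopAt r' j
    step {j} {r} {r'} G j<k hr = unfold-def (placed H 2 refl) _
      ((λ j≡k → ⊥-elim (<-irrefl j≡k j<k)) ,
       (λ _ → ≈-args (ev-++ (v₁ ∷ v₀ ∷ window 3 n) (v₁ ∷ after 2)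
                        (cong (λ zs → j ∷ r' ∷ zs) (ev-window (r' ∷ j ∷ k ∷ []) xs es))
                        (cong (j ∷_) (ev-after (r' ∷ j ∷ []) (k ∷ xs ++ es))))
                (simg (j ∷ r' ∷ xs) (j ∷ k ∷ xs ++ es) G
                  (follow (placed H 3 refl) _
                    (cong (λ zs → r ∷ suc j ∷ zs) (ev-after (r ∷ j ∷ []) (k ∷ xs ++ es))) hr))))

    iterate : ∀ {j r} → prec f g ▹ (j ∷ xs) ⇓ r → j ≤ k → LoopAt r j → ⟪ b , k ∷ xs ++ es ⟫≈ T
    iterate (e-prz Df)   _   hr = start Df hr
    iterate (e-prs Dj G) j<k hr = iterate Dj (<⇒≤ j<k) (step G j<k hr)

  sim-mu : ∀ {n m K b} {f : Rec (suc n)} → CodeAt Γ b (compile (mu f) m K b) →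
           Sim f (1 + (n + m)) (2 + b) (3 + b) → Sim (mu f) m K b
  sim-mu {n} {m} {K} {b} {f} H simf xs es (e-mu {k = k} Dk below) h =
    follow (placed H 0 refl) _ (cong (0 ∷_) (ev-all _)) (search k 0 (+-identityʳ k))
    where
    try : ∀ {j v} → f ▹ (j ∷ xs) ⇓ v → ⟪ 2 + b , v ∷ j ∷ xs ++ es ⟫≈ T → ⟪ 1 + b , j ∷ xs ++ es ⟫≈ T
    try {j} Dj hv =
      follow (placed H 1 refl) _
        (ev-++ (v₀ ∷ window 1 n) allParams (cong (j ∷_) (ev-window (j ∷ []) xs es)) (ev-all _))
        (simf (j ∷ xs) (j ∷ xs ++ es) Dj hv)

    search : ∀ d j → d + j ≡ k → ⟪ 1 + b , j ∷ xs ++ es ⟫≈ T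
    search zero j refl = try Dk (unfold-def (placed H 2 refl) _
      ((λ _ → ≈-args (cong (j ∷_) (ev-rest (0 ∷ j ∷ []) xs es)) h) , (λ 0≢0 → ⊥-elim (0≢0 refl))))
    search (suc d) j d+j≡k with below j (subst (suc j ≤_) d+j≡k (s≤s (m≤n+m j d)))
    ... | v , Dv = try Dv (unfold-def (placed H 2 refl) _
      ((λ ()) , (λ _ → ≈-args (cong (suc j ∷_) (ev-after (suc v ∷ j ∷ []) (xs ++ es)))
                              (search d (suc j) (trans (+-suc d j) d+j≡k)))))

  sims-nil : ∀ {n m K b} → CodeAt Γ b (compiles {n} [] m K b) → Sims {n} [] m K b
  sims-nil H xs es e-[] h = follow (placed H 0 refl) _ (ev-rest [] xs es) h

  sims-cons : ∀ {n k m K b} {g : Rec n} {gs : Vec (Rec n) k} → CodeAt Γ b (compiles (g ∷ gs) m K b) →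
              Sim g (n + m) (1 + b) (3 + b) → Sims gs (suc m) (2 + b) (size g + (3 + b)) →
              Sims (g ∷ gs) m K b
  sims-cons {n} {k} H simg simgs xs es (e-∷ {y = y} {ys = ys} Dg Dgs) h =
    follow (placed H 0 refl) _ (ev-++ (window 0 n) allParams (ev-window [] xs es) (ev-all _))
      (simg xs (xs ++ es) Dg
        (follow (placed H 1 refl) _
          (ev-++ (window 1 n) (v₀ ∷ rest 1 n) (ev-window (y ∷ []) xs es) (cong (y ∷_) (ev-rest (y ∷ []) xs es)))
          (simgs xs (y ∷ es) Dgs
            (follow (placed H 2 refl) _
              (ev-++ (window k 1) (window 0 k ++ rest k 1) (ev-window ys (y ∷ []) es)
                (ev-++ (window 0 k) (rest k 1) (ev-window [] ys (y ∷ es)) (ev-rest ys (y ∷ []) es)))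
              h))))

  mutual
    compile-sound : ∀ {n} (g : Rec n) m K b → CodeAt Γ b (compile g m K b) → Sim g m K b
    compile-sound zer m K b H      = sim-zer H
    compile-sound sc m K b H       = sim-sc H
    compile-sound (proj i) m K b H = sim-proj H
    compile-sound (comp f gs) m K b H =
      sim-comp (compiles-sound gs m _ b (code-left codeGs H))
               (compile-sound f m K _ (code-right codeGs (compiles-length gs m _ b) H))
      where
      codeGs : List StructDef
      codeGs = compiles gs m (sizes gs + b) b
    compile-sound {suc n} (prec f g) m K b H =
      sim-prec H (compile-sound f _ _ _ (code-left codeF Hbody))
                 (compile-sound g _ _ _ (code-right codeF (compile-length f _ _ _) Hbody))
      where
      codeF : List StructDef
      codeF = compile f (suc (n + m)) (1 + b) (4 + b)
      Hbody : CodeAt Γ (4 + b) (codeF List.++ compile g (2 + (n + m)) (3 + b) (size f + (4 + b)))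
      Hbody = code-tail (code-tail (code-tail (code-tail H)))
    compile-sound (mu f) m K b H =
      sim-mu H (compile-sound f _ _ _ (code-tail (code-tail (code-tail H))))

    compiles-sound : ∀ {n k} (gs : Vec (Rec n) k) m K b → CodeAt Γ b (compiles gs m K b) → Sims gs m K b
    compiles-sound [] m K b H = sims-nil H
    compiles-sound {n} (g ∷ gs) m K b H =
      sims-cons H (compile-sound g _ _ _ (code-left codeG Hbody))
                  (compiles-sound gs _ _ _ (code-right codeG (compile-length g _ _ _) Hbody))
      where
      codeG : List StructDef
      codeG = compile g (n + m) (1 + b) (3 + b)
      Hbody : CodeAt Γ (3 + b) (codeG List.++ compiles gs (suc m) (2 + b) (size g + (3 + b)))
      Hbody = code-tail (code-tail (code-tail H))

selfCallProgram : List Def → Program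
selfCallProgram Δ = mkProg Δ (call 0 (num (encDefs Δ) ∷ []))

const : ℕ → Rec 1
const zero    = comp zer []
const (suc c) = comp sc (const c ∷ [])

const-computes : ∀ c x → const c ▹ (x ∷ []) ⇓ c
const-computes zero    x = e-comp e-[] e-zer
const-computes (suc c) x = e-comp (e-∷ (const-computes c x) e-[]) e-sc

predR : Rec 1
predR = prec zer (proj fzero)

pred-computes : ∀ x → predR ▹ (x ∷ []) ⇓ (x ∸ 1)
pred-computes zero    = e-prz e-zer
pred-computes (suc x) = e-prs (pred-computes x) e-proj

addR : Rec 2
addR = prec (proj fzero) (comp sc (proj (fsuc fzero) ∷ []))

add-computes : ∀ a b → addR ▹ (a ∷ b ∷ []) ⇓ (a + b)
add-computes zero    b = e-prz e-proj
add-computes (suc a) b = e-prs (add-computes a b) (e-comp (e-∷ e-proj e-[]) e-sc)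

mulR : Rec 2
mulR = prec (const 0) (comp addR (proj (fsuc fzero) ∷ proj (fsuc (fsuc fzero)) ∷ []))

mul-computes : ∀ a b → mulR ▹ (a ∷ b ∷ []) ⇓ (a * b)
mul-computes zero    b = e-prz (const-computes 0 b)
mul-computes (suc a) b = subst (mulR ▹ (suc a ∷ b ∷ []) ⇓_) (+-comm (a * b) b)
  (e-prs (mul-computes a b) (e-comp (e-∷ e-proj (e-∷ e-proj e-[])) (add-computes (a * b) b)))

pow2R : Rec 1
pow2R = prec (comp sc (zer ∷ [])) (comp addR (proj (fsuc fzero) ∷ proj (fsuc fzero) ∷ []))

pow2-computes : ∀ a → pow2R ▹ (a ∷ []) ⇓ (2 ^ a)
pow2-computes zero    = e-prz (e-comp (e-∷ e-zer e-[]) e-sc)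
pow2-computes (suc a) = subst (pow2R ▹ (suc a ∷ []) ⇓_) (cong (2 ^ a +_) (sym (+-identityʳ (2 ^ a))))
  (e-prs (pow2-computes a) (e-comp (e-∷ e-proj (e-∷ e-proj e-[])) (add-computes (2 ^ a) (2 ^ a))))

pairR : Rec 2
pairR = comp predR (comp mulR (comp pow2R (proj fzero ∷ [])
                             ∷ comp sc (comp addR (proj (fsuc fzero) ∷ proj (fsuc fzero) ∷ []) ∷ []) ∷ []) ∷ [])

pair-computes : ∀ a b → pairR ▹ (a ∷ b ∷ []) ⇓ pair a b
pair-computes a b = subst (pairR ▹ (a ∷ b ∷ []) ⇓_) (cong (λ z → 2 ^ a * z ∸ 1) odd)
  (e-comp (e-∷ (e-comp (e-∷ (e-comp (e-∷ e-proj e-[]) (pow2-computes a))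
                       (e-∷ (e-comp (e-∷ (e-comp (e-∷ e-proj (e-∷ e-proj e-[])) (add-computes b b)) e-[]) e-sc)
                            e-[]))
                (mul-computes (2 ^ a) (suc (b + b)))) e-[])
          (pred-computes (2 ^ a * suc (b + b))))
  where
  odd : suc (b + b) ≡ 2 * b + 1
  odd = sym (trans (+-comm (2 * b) 1) (cong suc (cong (b +_) (+-identityʳ b))))

pairing : Rec 1 → Rec 1 → Rec 1
pairing A C = comp pairR (A ∷ C ∷ [])

pairing-computes : ∀ {A C xs a c} → A ▹ xs ⇓ a → C ▹ xs ⇓ c → pairing A C ▹ xs ⇓ pair a c
pairing-computes {a = a} {c = c} DA DC = e-comp (e-∷ DA (e-∷ DC e-[])) (pair-computes a c)

-- x ↦ ⌜(x, call 0 (num x ∷ []))⌝, following the clauses of the numbering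
selfCall : Rec 1
selfCall = pairing (proj fzero)
  (pairing (const 6) (pairing (const 0) (comp sc (pairing (pairing (const 0) (proj fzero)) (const 0) ∷ []))))

selfCall-computes : ∀ Δ → selfCall ▹ (encDefs Δ ∷ []) ⇓ ⌜ selfCallProgram Δ ⌝
selfCall-computes Δ =
  pairing-computes e-proj
    (pairing-computes (const-computes 6 x)
      (pairing-computes (const-computes 0 x)
        (e-comp (e-∷ (pairing-computes (pairing-computes (const-computes 0 x) e-proj) (const-computes 0 x)) e-[])
                e-sc)))
  where
  x : ℕ
  x = encDefs Δ

selfCallProcess : List StructDef → Program
selfCallProcess Γ = selfCallProgram (List.map embed Γ)

selfCall-is-process : ∀ Γ → IsProcess (selfCallProcess Γ)
selfCall-is-process Γ = w-call (w-num ∷ []) , wf-embed Γ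

verdict : StructDef
verdict = 1 , branch v₀ (lit 1) emit stop

diagonalFn : Rec 1 → Rec 1
diagonalFn f = comp f (selfCall ∷ [])

diagonalCode : Rec 1 → List StructDef
diagonalCode f = compile (diagonalFn f) 0 (size (diagonalFn f)) 0 List.++ verdict ∷ []

DiagonalLayout : Rec 1 → List StructDef → Set
DiagonalLayout f Γ = CodeAt Γ 0 (compile (diagonalFn f) 0 (size (diagonalFn f)) 0)
                   × lookupAt Γ (size (diagonalFn f)) ≡ just verdict

diagonalCode-layout : ∀ f → DiagonalLayout f (diagonalCode f)
diagonalCode-layout f =
  code-left codeF (code-whole (diagonalCode f)) ,
  subst (λ a → lookupAt (diagonalCode f) a ≡ just verdict) (compile-length (diagonalFn f) 0 _ 0)
    (lookupAt-length codeF)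
  where
  codeF : List StructDef
  codeF = compile (diagonalFn f) 0 (size (diagonalFn f)) 0

-- Γ stays abstract here: the argument only uses its layout (unfolding a
-- concrete Γ would make the type checker compute Gödel numbers).
-- Below P stands for selfCallProcess Γ.
module Diagonal (f : Rec 1) (Γ : List StructDef) where

  open Behaviour Γ

  P-behaves : ∀ {y T} → DiagonalLayout f Γ → f ▹ (⌜ selfCallProcess Γ ⌝ ∷ []) ⇓ y →
              Behaves (proj₂ verdict) (y ∷ []) T → main (selfCallProcess Γ) ≈ T
  P-behaves {y} {T} (code-placed , verdict-placed) Df hv =
    Soundness.compile-sound Γ T (diagonalFn f) 0 (size (diagonalFn f)) 0 code-placed
      (encDefs Δ ∷ []) [] (e-comp (e-∷ (selfCall-computes Δ) e-[]) Df)
      (unfold-def verdict-placed (y ∷ []) hv) (num (encDefs Δ) ∷ []) (closed-num ∷ [])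

  observable : DiagonalLayout f Γ → f ▹ (⌜ selfCallProcess Γ ⌝ ∷ []) ⇓ 1 → ¬ Unobservable (selfCallProcess Γ)
  observable layout Df = emitting-observable
    (from (P-behaves layout Df ((λ _ → ≈-refl) , (λ 1≢1 → ⊥-elim (1≢1 refl))) (outA 0 0))
          (nil , s-out 0 (λ _ → refl)))

  unobservable : DiagonalLayout f Γ → f ▹ (⌜ selfCallProcess Γ ⌝ ∷ []) ⇓ 0 → Unobservable (selfCallProcess Γ)
  unobservable layout Df = inert-unobservable λ s →
    nil-inert (proj₂ (to (P-behaves layout Df ((λ ()) , (λ _ → ≈-refl)) _) (_ , s)))
    where
    nil-inert : Inert nil
    nil-inert ()

corollary5p3 : ¬ DecidableProcessProperty Unobservable
corollary5p3 (f , decides) = observableP (Diagonal.unobservable f Γ layout (says-observable observableP))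
  where
  Γ : List StructDef
  Γ = diagonalCode f

  layout : DiagonalLayout f Γ
  layout = diagonalCode-layout f

  says-unobservable : Unobservable (selfCallProcess Γ) → f ▹ (⌜ selfCallProcess Γ ⌝ ∷ []) ⇓ 1
  says-unobservable = proj₁ (decides (selfCallProcess Γ) (selfCall-is-process Γ))

  says-observable : ¬ Unobservable (selfCallProcess Γ) → f ▹ (⌜ selfCallProcess Γ ⌝ ∷ []) ⇓ 0
  says-observable = proj₂ (decides (selfCallProcess Γ) (selfCall-is-process Γ))

  -- if P were unobservable, f would answer 1 and P would be observable
  observableP : ¬ Unobservable (selfCallProcess Γ)
  observableP u = Diagonal.observable f Γ layout (says-unobservable u) u
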